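{- Let $\mathbf{C}$ be a presheaf topos and let $c,b\in\mathrm{AC}(R)$ be arrow-based conditions. If $m:c\to b$ is a forward-shift or a backward-shift condition morphism, then for every arrow $g:R\to G$, $g\models b$ implies $g\models c$.
   Context: Composition is written in diagrammatic order: $f;g$ is $f$ followed by $g$. Ab-conditions. For an object $R$, $\mathrm{AC}(R)$ (ab-conditions) and $\mathrm{AB}(R)$ (ab-branches) are the smallest sets such that: - $c=(R,p_1\cdots p_w)\in\mathrm{AC}(R)$ for $w\ge0$ and $p_i\in\mathrm{AB}(R)$; - $(a,c')\in\mathrm{AB}(R)$ for an arrow $a:R\to P$ and $c'\in\mathrm{AC}(P)$. We write $|c|=w$ and $p^c_i=(a^c_i,c_i)$, with $a^c_i:R\to P^c_i$. Satisfaction. $g:R\to G$ satisfies $c$ ($g\models c$) iff there are $i$ and $h:P^c_i\to G$ with $g=a^c_i;h$ and $h\not\models c_i$. Source shifters. A source shifter from $X$ to $Y$ is a family $\mathcal{S}_Z:\mathbf{C}(X,Z)\to\mathbf{C}(Y,Z)$ with $\mathcal{S}(a;t)=\mathcal{S}(a);t$. - Forward source shifter for $v:A\to B$: a source shifter from $A$ to $B$ with $v;g=a;h\Rightarrow g=\mathcal{S}(a);h$ for all $a:A\to C$, $g:B\to G$, $h:C\to G$. - Backward source shifter for $v$: a source shifter from $B$ to $A$ with $v;g=\mathcal{S}(a);h\Rightarrow g=a;h$ for all $a:B\to C$, $g:B\to G$, $h:C\to G$. Root shifters. $\bar{\mathcal{S}}(c)=(Y,(\mathcal{S}(a^c_1),c_1)\cdots(\mathcal{S}(a^c_{|c|}),c_{|c|}))$.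 The trivial $\mathcal{I}_{X,Y}$ is defined only on zero-width conditions, by $(X,\epsilon)\mapsto(Y,\epsilon)$. - A forward root shifter for $v:A\to B$ is $\bar{\mathcal{F}}$ ($\mathcal{F}$ a forward source shifter for $v$) or $\mathcal{I}_{A,B}$. - A backward root shifter for $v$ is $\bar{\mathcal{B}}$ ($\mathcal{B}$ a backward source shifter for $v$) or $\mathcal{I}_{B,A}$. Morphisms. For $c,b\in\mathrm{AC}(R)$, a forward-shift (resp. backward-shift) condition morphism $m:c\to b$ is a tuple $(o,(v_1,m_1)\cdots(v_{|b|},m_{|b|}))$, defined inductively on depth, where: - $o:[1,|b|]\to[1,|c|]$; - $v_i:P^c_{o(i)}\to P^b_i$ with $a^c_{o(i)};v_i=a^b_i$; - forward case: for each $i$ there is a forward root shifter $\mathcal{F}_i$ for $v_i$, defined on $c_{o(i)}$, with $m_i$ a forward-shift morphism $b_i\to\mathcal{F}_i(c_{o(i)})$; - backward case: for each $i$ there is a backward root shifter $\mathcal{B}_i$ for $v_i$, defined on $b_i$, with $m_i$ a backward-shift morphism $\mathcal{B}_i(b_i)\to c_{o(i)}$. -}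

module Defs where

open import Level using (Level; _⊔_; suc)
open import Data.Nat using (ℕ)
open import Data.Fin using (Fin)
open import Data.Product using (Σ; Σ-syntax; _×_; _,_)
open import Relation.Nullary using (¬_)
open import Relation.Binary.PropositionalEquality using (_≡_; refl; sym; trans; cong)

-- Categories with setoid-valued hom-sets; composition is DIAGRAMMATIC:
-- f ⨾ g is f followed by g.

record Category (o ℓ e : Level) : Set (suc (o ⊔ ℓ ⊔ e)) where
  infixr 9 _⨾_
  infix  4 _≈_
  field
    Obj   : Set o
    _⇒_   : Obj → Obj → Set ℓ
    _≈_   : ∀ {A B} → A ⇒ B → A ⇒ B → Set e
    id    : ∀ {A} → A ⇒ A
    _⨾_   : ∀ {A B C} → A ⇒ B → B ⇒ C → A ⇒ C
    ≈-refl  : ∀ {A B} {f : A ⇒ B} → f ≈ f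
    ≈-sym   : ∀ {A B} {f g : A ⇒ B} → f ≈ g → g ≈ f
    ≈-trans : ∀ {A B} {f g h : A ⇒ B} → f ≈ g → g ≈ h → f ≈ h
    assoc   : ∀ {A B C D} {f : A ⇒ B} {g : B ⇒ C} {h : C ⇒ D} →
              (f ⨾ g) ⨾ h ≈ f ⨾ (g ⨾ h)
    identityˡ : ∀ {A B} {f : A ⇒ B} → id ⨾ f ≈ f
    identityʳ : ∀ {A B} {f : A ⇒ B} → f ⨾ id ≈ f
    ⨾-resp-≈  : ∀ {A B C} {f f' : A ⇒ B} {g g' : B ⇒ C} →
                f ≈ f' → g ≈ g' → f ⨾ g ≈ f' ⨾ g'

module _ {o ℓ e : Level} (𝔸 : Category o ℓ e) (p : Level) where
  private module 𝔸 = Category 𝔸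
  open 𝔸 using (Obj; _⇒_; _≈_; _⨾_)

  record Presheaf : Set (o ⊔ ℓ ⊔ e ⊔ suc p) where
    field
      F₀ : Obj → Set p
      F₁ : ∀ {A B} → A ⇒ B → F₀ B → F₀ A
      F-resp-≈ : ∀ {A B} {f g : A ⇒ B} → f ≈ g → ∀ x → F₁ f x ≡ F₁ g x
      F-id     : ∀ {A} x → F₁ (𝔸.id {A}) x ≡ x
      F-comp   : ∀ {A B C} (f : A ⇒ B) (g : B ⇒ C) x →
                 F₁ (f ⨾ g) x ≡ F₁ f (F₁ g x)

  open Presheaf

  record NatTrans (F G : Presheaf) : Set (o ⊔ ℓ ⊔ p) where
    field
      η       : ∀ A → F₀ F A → F₀ G A
      natural : ∀ {A B} (f : A ⇒ B) x → η A (F₁ F f x) ≡ F₁ G f (η B x)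

  open NatTrans

  PSh : Category (o ⊔ ℓ ⊔ e ⊔ suc p) (o ⊔ ℓ ⊔ p) (o ⊔ p)
  PSh = record
    { Obj = Presheaf
    ; _⇒_ = NatTrans
    ; _≈_ = λ α β → ∀ A x → η α A x ≡ η β A x
    ; id  = record { η = λ _ x → x ; natural = λ _ _ → refl }
    ; _⨾_ = λ {F} {G} {H} α β → record
        { η = λ A x → η β A (η α A x)
        ; natural = λ f x → trans (cong (η β _) (natural α f x)) (natural β f (η α _ x)) }
    ; ≈-refl  = λ _ _ → refl
    ; ≈-sym   = λ q A x → sym (q A x)
    ; ≈-trans = λ q r A x → trans (q A x) (r A x)
    ; assoc   = λ _ _ → refl
    ; identityˡ = λ _ _ → refl
    ; identityʳ = λ _ _ → refl
    ; ⨾-resp-≈  = λ {_} {_} {_} {f} {f'} {g} {g'} q r A x →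
        trans (cong (η g A) (q A x)) (r A (η f' A x))
    }

module Conditions {o ℓ e : Level} (C : Category o ℓ e) where
  open Category C

  -- AC(R): a condition of width w is a family of w branches (indices Fin w,
  -- corresponding to [1,w]); AB(R): a branch (a : R → P, c' ∈ AC(P)).
  data AC (R : Obj) : Set (o ⊔ ℓ)
  data AB (R : Obj) : Set (o ⊔ ℓ)

  data AC R where
    cond : (w : ℕ) → (Fin w → AB R) → AC R

  data AB R where
    branch : {P : Obj} → R ⇒ P → AC P → AB R

  width : ∀ {R} → AC R → ℕ
  width (cond w _) = w

  branchObj : ∀ {R} → AB R → Obj
  branchObj (branch {P} _ _) = P

  branchArr : ∀ {R} (q : AB R) → R ⇒ branchObj q
  branchArr (branch a _) = a

  branchCond : ∀ {R} (q : AB R) → AC (branchObj q)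
  branchCond (branch _ c') = c'

  br : ∀ {R} (c : AC R) → Fin (width c) → AB R
  br (cond _ ps) i = ps i

  P : ∀ {R} (c : AC R) → Fin (width c) → Obj
  P c i = branchObj (br c i)

  a : ∀ {R} (c : AC R) (i : Fin (width c)) → R ⇒ P c i
  a c i = branchArr (br c i)

  sub : ∀ {R} (c : AC R) (i : Fin (width c)) → AC (P c i)
  sub c i = branchCond (br c i)

  infix 4 _⊨_ _⊨B_
  _⊨_  : ∀ {R G} → R ⇒ G → AC R → Set (o ⊔ ℓ ⊔ e)
  _⊨B_ : ∀ {R G} → R ⇒ G → AB R → Set (o ⊔ ℓ ⊔ e)
  g ⊨ cond w ps = Σ[ i ∈ Fin w ] (g ⊨B ps i)
  _⊨B_ {G = G} g (branch {P'} a' c') =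
    Σ[ h ∈ P' ⇒ G ] ((g ≈ a' ⨾ h) × ¬ (h ⊨ c'))

  record SourceShifter (X Y : Obj) : Set (o ⊔ ℓ ⊔ e) where
    field
      S       : ∀ {Z} → X ⇒ Z → Y ⇒ Z
      S-resp-≈ : ∀ {Z} {f f' : X ⇒ Z} → f ≈ f' → S f ≈ S f'
      S-comp  : ∀ {Z W} (f : X ⇒ Z) (t : Z ⇒ W) → S (f ⨾ t) ≈ S f ⨾ t

  open SourceShifter public

  record ForwardSourceShifter {A B : Obj} (v : A ⇒ B) : Set (o ⊔ ℓ ⊔ e) where
    field
      shifter : SourceShifter A B
      forward : ∀ {Cc G} (a' : A ⇒ Cc) (g : B ⇒ G) (h : Cc ⇒ G) →
                v ⨾ g ≈ a' ⨾ h → g ≈ S shifter a' ⨾ h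

  record BackwardSourceShifter {A B : Obj} (v : A ⇒ B) : Set (o ⊔ ℓ ⊔ e) where
    field
      shifter  : SourceShifter B A
      backward : ∀ {Cc G} (a' : B ⇒ Cc) (g : B ⇒ G) (h : Cc ⇒ G) →
                 v ⨾ g ≈ S shifter a' ⨾ h → g ≈ a' ⨾ h

  open ForwardSourceShifter public using (shifter)

  shiftRoot : ∀ {X Y} → SourceShifter X Y → AC X → AC Y
  shiftRoot 𝒮 (cond w ps) = cond w (λ i → shift (ps i))
    where
    shift : AB _ → AB _
    shift (branch a' c') = branch (S 𝒮 a') c'

  trivialRoot : ∀ {X Y} → (c : AC X) → width c ≡ 0 → AC Y
  trivialRoot _ _ = cond 0 (λ ())

  data ForwardRootShifter {A B : Obj} (v : A ⇒ B) (c : AC A) : Set (o ⊔ ℓ ⊔ e) where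
    induced : ForwardSourceShifter v → ForwardRootShifter v c
    trivial : width c ≡ 0 → ForwardRootShifter v c

  applyF : ∀ {A B} {v : A ⇒ B} {c : AC A} → ForwardRootShifter v c → AC B
  applyF {c = c} (induced 𝓕) = shiftRoot (ForwardSourceShifter.shifter 𝓕) c
  applyF {c = c} (trivial z) = trivialRoot c z

  data BackwardRootShifter {A B : Obj} (v : A ⇒ B) (b : AC B) : Set (o ⊔ ℓ ⊔ e) where
    induced : BackwardSourceShifter v → BackwardRootShifter v b
    trivial : width b ≡ 0 → BackwardRootShifter v b

  applyB : ∀ {A B} {v : A ⇒ B} {b : AC B} → BackwardRootShifter v b → AC A
  applyB {b = b} (induced 𝓑) = shiftRoot (BackwardSourceShifter.shifter 𝓑) b
  applyB {b = b} (trivial z) = trivialRoot b z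

  data FwdMor {R : Obj} (c b : AC R) : Set (o ⊔ ℓ ⊔ e) where
    fmor : (ord : Fin (width b) → Fin (width c)) →
           ((i : Fin (width b)) →
              Σ[ v ∈ P c (ord i) ⇒ P b i ]
                ((a c (ord i) ⨾ v ≈ a b i) ×
                 Σ[ 𝓕 ∈ ForwardRootShifter v (sub c (ord i)) ]
                   FwdMor (sub b i) (applyF 𝓕))) →
           FwdMor c b

  data BwdMor {R : Obj} (c b : AC R) : Set (o ⊔ ℓ ⊔ e) where
    bmor : (ord : Fin (width b) → Fin (width c)) →
           ((i : Fin (width b)) →
              Σ[ v ∈ P c (ord i) ⇒ P b i ]
                ((a c (ord i) ⨾ v ≈ a b i) ×
                 Σ[ 𝓑 ∈ BackwardRootShifter v (sub b i) ]
                   BwdMor (applyB 𝓑) (sub c (ord i)))) →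
           BwdMor c b

module PShConditions {o ℓ e : Level} (𝔸 : Category o ℓ e) (p : Level) where
  open Category (PSh 𝔸 p) public
  open Conditions (PSh 𝔸 p) public

{-# OPTIONS --safe #-}
module Submission where

open import Defs
open import Level using (Level; _⊔_)
open import Data.Fin using (Fin)
open import Data.Sum using (_⊎_; inj₁; inj₂)
open import Data.Product using (Σ-syntax; _×_; _,_)
open import Function.Base using (_∘_; case_of_)
open import Function.Bundles using (_⇔_; mk⇔; Equivalence)
open import Relation.Binary.PropositionalEquality using (refl)

-- Nothing about presheaves is used: the argument works in any category.
-- A witness (i, h) of g ⊨ b is sent to branch o(i) of c with the arrow v_i ⨾ h.
-- That v_i ⨾ h ⊭ c_o(i) follows from h ⊭ b_i by the same statement one level
-- deeper, transported along v_i by the root shifter; trivial root shifters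
-- only meet the unsatisfiable zero-width condition.
module _ {o ℓ e : Level} (C : Category o ℓ e) where
  open Category C
  open Conditions C
  open Equivalence using (to; from)
  open ForwardSourceShifter using (forward)
  open BackwardSourceShifter using (backward)

  ⊨B-branch : ∀ {R G} {g : R ⇒ G} (q : AB R) →
              g ⊨B q ⇔ g ⊨B branch (branchArr q) (branchCond q)
  ⊨B-branch (branch _ _) = mk⇔ (λ s → s) (λ s → s)

  ⊨-cond : ∀ {R G} {g : R ⇒ G} (c : AC R) →
           g ⊨ c ⇔ (Σ[ i ∈ Fin (width c) ] g ⊨B branch (a c i) (sub c i))
  ⊨-cond (cond w ps) =
    mk⇔ (λ (i , s) → i , to (⊨B-branch (ps i)) s)
        (λ (i , s) → i , from (⊨B-branch (ps i)) s)

  ⊨-shiftRoot : ∀ {X Y G} {h : Y ⇒ G} (𝒮 : SourceShifter X Y) (c : AC X) →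
                h ⊨ shiftRoot 𝒮 c ⇔
                (Σ[ i ∈ Fin (width c) ] h ⊨B branch (S 𝒮 (a c i)) (sub c i))
  ⊨-shiftRoot {h = h} 𝒮 (cond w ps) =
    mk⇔ (λ (i , s) → i , shifted i s) (λ (i , s) → i , unshifted i s)
    where
    shifted   : ∀ i → h ⊨B br (shiftRoot 𝒮 (cond w ps)) i →
                h ⊨B branch (S 𝒮 (branchArr (ps i))) (branchCond (ps i))
    shifted i s with ps i
    ... | branch _ _ = s
    unshifted : ∀ i → h ⊨B branch (S 𝒮 (branchArr (ps i))) (branchCond (ps i)) →
                h ⊨B br (shiftRoot 𝒮 (cond w ps)) i
    unshifted i s with ps i
    ... | branch _ _ = s

  Entails : ∀ {X Y} → X ⇒ Y → AC X → AC Y → Set (o ⊔ ℓ ⊔ e)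
  Entails {Y = Y} v c′ b′ = ∀ {G} (h : Y ⇒ G) → v ⨾ h ⊨ c′ → h ⊨ b′

  ⊨-applyF : ∀ {A B} {v : A ⇒ B} {c : AC A} (𝓕 : ForwardRootShifter v c) →
             Entails v c (applyF 𝓕)
  ⊨-applyF {c = cond .0 _} (trivial refl) h (() , _)
  ⊨-applyF {c = c} (induced 𝓕) h sat with to (⊨-cond c) sat
  ... | i , k , v⨾h≈a⨾k , k⊭ =
    from (⊨-shiftRoot (shifter 𝓕) c)
      (i , k , forward 𝓕 _ h k v⨾h≈a⨾k , k⊭)

  ⊨-applyB : ∀ {A B} {v : A ⇒ B} {b : AC B} (𝓑 : BackwardRootShifter v b) →
             Entails v (applyB 𝓑) b
  ⊨-applyB (trivial _) h (() , _)
  ⊨-applyB {b = b} (induced 𝓑) h sat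
    with to (⊨-shiftRoot (BackwardSourceShifter.shifter 𝓑) b) sat
  ... | i , k , v⨾h≈Sa⨾k , k⊭ =
    from (⊨-cond b) (i , k , backward 𝓑 _ h k v⨾h≈Sa⨾k , k⊭)

  ≈-factor : ∀ {R X Y G} {g : R ⇒ G} {a′ : R ⇒ X} {v : X ⇒ Y} {a″ : R ⇒ Y} {h : Y ⇒ G} →
             a′ ⨾ v ≈ a″ → g ≈ a″ ⨾ h → g ≈ a′ ⨾ (v ⨾ h)
  ≈-factor a′⨾v≈a″ g≈a″⨾h =
    ≈-trans g≈a″⨾h (≈-trans (⨾-resp-≈ (≈-sym a′⨾v≈a″) ≈-refl) assoc)

  ⊨-branchwise : ∀ {R} {c b : AC R} (ord : Fin (width b) → Fin (width c)) →
                 (∀ i → Σ[ v ∈ P c (ord i) ⇒ P b i ]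
                          ((a c (ord i) ⨾ v ≈ a b i) × Entails v (sub c (ord i)) (sub b i))) →
                 ∀ {G} (g : R ⇒ G) → g ⊨ b → g ⊨ c
  ⊨-branchwise {c = c} {b} ord branchwise g sat with to (⊨-cond b) sat
  ... | i , h , g≈a⨾h , h⊭ with branchwise i
  ... | v , a⨾v≈a , entails =
    from (⊨-cond c) (ord i , v ⨾ h , ≈-factor a⨾v≈a g≈a⨾h , λ v⨾h⊨ → h⊭ (entails h v⨾h⊨))

  ⊨-FwdMor : ∀ {R} {c b : AC R} → FwdMor c b → ∀ {G} (g : R ⇒ G) → g ⊨ b → g ⊨ c
  ⊨-FwdMor (fmor ord m) = ⊨-branchwise ord λ i → case m i of λ where
    (v , comm , 𝓕 , m′) → v , comm , λ {_} h → ⊨-FwdMor m′ h ∘ ⊨-applyF 𝓕 h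

  ⊨-BwdMor : ∀ {R} {c b : AC R} → BwdMor c b → ∀ {G} (g : R ⇒ G) → g ⊨ b → g ⊨ c
  ⊨-BwdMor (bmor ord m) = ⊨-branchwise ord λ i → case m i of λ where
    (v , comm , 𝓑 , m′) → v , comm , λ {_} h → ⊨-applyB 𝓑 h ∘ ⊨-BwdMor m′ (v ⨾ h)

proposition4 : {o ℓ e : Level} (𝔸 : Category o ℓ e) (p : Level) →
    let module K = PShConditions 𝔸 p in
    {R : K.Obj} (c b : K.AC R) →
    (K.FwdMor c b ⊎ K.BwdMor c b) →
    {G : K.Obj} (g : R K.⇒ G) → g K.⊨ b → g K.⊨ c
proposition4 𝔸 p c b (inj₁ m) = ⊨-FwdMor (PSh 𝔸 p) m
proposition4 𝔸 p c b (inj₂ m) = ⊨-BwdMor (PSh 𝔸 p) m
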